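{- Let $a,n$ be integers with $1<a<n-1$, and let $\sigma$ be a uniformly random permutation of $\{1,\ldots,n\}$. Then $\Pr[D_{a,1}(\sigma)=0]\le\frac{n}{2(n-1)(a+1)}$.
   Context: For positive integers $a,b$ with $a+b<n$ and a permutation $\sigma$ of $\{1,\ldots,n\}$, define $D_{a,b}(\sigma)=\sum_{i=1}^{a}\sigma(i)-\sum_{i=a+1}^{a+b}\sigma(i)$. -}

module Defs where

open import Data.Nat using (ℕ; zero; suc; _+_)
open import Data.Integer using (ℤ; +_; _-_)
open import Data.List using (List; []; _∷_; map; concatMap; take; drop; filter; length)
open import Relation.Binary.PropositionalEquality using (_≡_)
import Data.Integer.Properties as ℤP
open import Data.Nat.ListAction using (sum)

insertions : ℕ → List ℕ → List (List ℕ)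
insertions x []       = (x ∷ []) ∷ []
insertions x (y ∷ ys) = (x ∷ y ∷ ys) ∷ map (y ∷_) (insertions x ys)

-- perms n : the list of all permutations σ of {1,…,n}, each one written
-- as the list of values σ(1) ∷ σ(2) ∷ … ∷ σ(n) ∷ [] (each exactly once)
perms : ℕ → List (List ℕ)
perms zero    = [] ∷ []
perms (suc n) = concatMap (insertions (suc n)) (perms n)

D : ℕ → ℕ → List ℕ → ℤ
D a b σ = + sum (take a σ) - + sum (take b (drop a σ))

countZero : ℕ → ℕ → ℕ → ℕ
countZero n a b = length (filter (λ σ → D a b σ ℤP.≟ + 0) (perms n))

-- Write F(n) for the number of permutations σ of {1,…,n} with σ(a+1) = σ(1)+⋯+σ(a).
-- Inserting the new value n+1 into σ ∈ Sₙ at one of its n+1 positions kills the event when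
-- n+1 lands among the first a entries, creates it exactly when n+1 lands at position a+1 and
-- σ(1)+⋯+σ(a) = n+1, and preserves it at the remaining n-a positions:
--   F(n+1) = G(n) + (n-a) F(n),   G(n) = #{σ ∈ Sₙ : σ(1)+⋯+σ(a) = n+1}.
-- By exchangeability of the positions after a-1, position a is as likely to carry the unique value
-- completing the sum to n+1 as any of the n-a+1 positions from a on, so (n-a+1) G(n) ≤ n!.
-- Induction on n from n = a+2 then gives the bound.

module Submission where

open import Defs
open import Data.Nat using (ℕ; _+_; _*_; _∸_; _<_; _≤_)
open import Data.List using (length)

open import Data.Bool using (Bool; true; false)
open import Data.Bool.Properties using (¬-not; T-≡)
open import Data.Nat using (zero; suc; z≤n; s≤s; _≡ᵇ_)
open import Data.Nat.Properties
open import Algebra.Properties.CommutativeSemigroup +-commutativeSemigroup using (interchange)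
open import Data.Nat.ListAction using (sum)
open import Data.Nat.ListAction.Properties using (sum-++; sum-↭)
open import Data.Nat.Tactic.RingSolver using (solve-∀)
open import Data.List using (List; []; _∷_; map; concatMap; take; drop; filter; _++_)
open import Data.List.Properties using (map-++; map-∘; map-cong; length-drop; drop-all)
open import Data.List.Relation.Unary.All as All using (All; []; _∷_)
open import Data.List.Relation.Unary.All.Properties using (concat⁺; gmap⁺; map⁺; drop⁺)
open import Data.List.Relation.Unary.Unique.Propositional using (Unique; []; _∷_)
import Data.List.Relation.Unary.Unique.Propositional.Properties as Unique
open import Data.List.Relation.Binary.Permutation.Propositional
  using (_↭_; refl; prep; swap; trans; ↭-sym)
open import Data.List.Relation.Binary.Permutation.Propositional.Properties
  using (All-resp-↭; ↭-length)
import Data.List.Relation.Binary.Permutation.Propositional.Properties as ↭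
open import Data.Product using (_×_; _,_)
open import Data.Sum using (inj₁; inj₂)
open import Function using (_∘_; _$_)
open import Function.Bundles using (mk⇔; Equivalence)
open import Relation.Nullary using (does; ¬_)
open import Relation.Nullary.Decidable using (does-⇔)
open import Relation.Unary using (Decidable)
open import Relation.Binary.PropositionalEquality
  using (_≡_; refl; sym; cong; cong₂; subst; module ≡-Reasoning)
  renaming (trans to ≡-trans)
import Data.Integer as ℤ
import Data.Integer.Properties as ℤ

𝟙 : Bool → ℕ
𝟙 true  = 1
𝟙 false = 0

sumOver : ∀ {a} {A : Set a} → (A → ℕ) → List A → ℕ
sumOver w xs = sum (map w xs)

module _ {a} {A : Set a} where

  sumOver-cong : ∀ {w v : A → ℕ} → (∀ x → w x ≡ v x) → ∀ xs → sumOver w xs ≡ sumOver v xs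
  sumOver-cong w≗v xs = cong sum (map-cong w≗v xs)

  sumOver-congᴬ : ∀ {p} {P : A → Set p} {w v : A → ℕ} → (∀ {x} → P x → w x ≡ v x) →
                  ∀ {xs} → All P xs → sumOver w xs ≡ sumOver v xs
  sumOver-congᴬ w≗v []         = refl
  sumOver-congᴬ w≗v (px ∷ pxs) = cong₂ _+_ (w≗v px) (sumOver-congᴬ w≗v pxs)

  sumOver-monoᴬ : ∀ {p} {P : A → Set p} {w v : A → ℕ} → (∀ {x} → P x → w x ≤ v x) →
                  ∀ {xs} → All P xs → sumOver w xs ≤ sumOver v xs
  sumOver-monoᴬ w≤v []         = ≤-refl
  sumOver-monoᴬ w≤v (px ∷ pxs) = +-mono-≤ (w≤v px) (sumOver-monoᴬ w≤v pxs)

  sumOver-++ : ∀ w (xs ys : List A) → sumOver w (xs ++ ys) ≡ sumOver w xs + sumOver w ys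
  sumOver-++ w xs ys = ≡-trans (cong sum (map-++ w xs ys)) (sum-++ (map w xs) (map w ys))

  sumOver-↭ : ∀ w {xs ys : List A} → xs ↭ ys → sumOver w xs ≡ sumOver w ys
  sumOver-↭ w xs↭ys = sum-↭ (↭.map⁺ w xs↭ys)

  sumOver-+ : ∀ (w v : A → ℕ) xs → sumOver (λ x → w x + v x) xs ≡ sumOver w xs + sumOver v xs
  sumOver-+ w v []       = refl
  sumOver-+ w v (x ∷ xs) =
    ≡-trans (cong (w x + v x +_) (sumOver-+ w v xs)) (interchange (w x) (v x) _ _)

  sumOver-*ˡ : ∀ k (w : A → ℕ) xs → sumOver (λ x → k * w x) xs ≡ k * sumOver w xs
  sumOver-*ˡ k w []       = sym (*-zeroʳ k)
  sumOver-*ˡ k w (x ∷ xs) =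
    ≡-trans (cong (k * w x +_) (sumOver-*ˡ k w xs)) (sym (*-distribˡ-+ k (w x) _))

  sumOver-zero : ∀ (xs : List A) → sumOver (λ _ → 0) xs ≡ 0
  sumOver-zero []       = refl
  sumOver-zero (x ∷ xs) = sumOver-zero xs

  length≡sumOver-1 : ∀ (xs : List A) → length xs ≡ sumOver (λ _ → 1) xs
  length≡sumOver-1 []       = refl
  length≡sumOver-1 (x ∷ xs) = cong suc (length≡sumOver-1 xs)

  length-filter≡sumOver : ∀ {p} {P : A → Set p} (P? : Decidable P) xs →
                          length (filter P? xs) ≡ sumOver (𝟙 ∘ does ∘ P?) xs
  length-filter≡sumOver P? []       = refl
  length-filter≡sumOver P? (x ∷ xs) with does (P? x)
  ... | true  = cong suc (length-filter≡sumOver P? xs)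
  ... | false = length-filter≡sumOver P? xs

  sumOver-𝟙-≤1 : ∀ (P : A → Bool) → (∀ {u v} → P u ≡ true → P v ≡ true → u ≡ v) →
                 ∀ {xs} → Unique xs → sumOver (𝟙 ∘ P) xs ≤ 1
  sumOver-𝟙-≤1 P P-inj []                     = z≤n
  sumOver-𝟙-≤1 P P-inj {x ∷ xs} (x∉xs ∷ !xs) with P x in Px
  ... | false = sumOver-𝟙-≤1 P P-inj !xs
  ... | true  = s≤s (≤-reflexive (≡-trans (sumOver-congᴬ P≡false x∉xs) (sumOver-zero xs)))
    where
    P≡false : ∀ {y} → ¬ x ≡ y → 𝟙 (P y) ≡ 0
    P≡false x≢y = cong 𝟙 (¬-not (x≢y ∘ P-inj Px))

sumOver-map : ∀ {a b} {A : Set a} {B : Set b} (w : B → ℕ) (f : A → B) xs →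
              sumOver w (map f xs) ≡ sumOver (w ∘ f) xs
sumOver-map w f xs = cong sum (sym (map-∘ xs))

sumOver-concatMap : ∀ {a b} {A : Set a} {B : Set b} (w : B → ℕ) (f : A → List B) xs →
                    sumOver w (concatMap f xs) ≡ sumOver (sumOver w ∘ f) xs
sumOver-concatMap w f []       = refl
sumOver-concatMap w f (x ∷ xs) =
  ≡-trans (sumOver-++ w (f x) (concatMap f xs)) (cong (sumOver w (f x) +_) (sumOver-concatMap w f xs))

sumBelow : ℕ → (ℕ → ℕ) → ℕ
sumBelow zero    f = 0
sumBelow (suc n) f = f 0 + sumBelow n (f ∘ suc)

sumBelow-cong : ∀ n {f g : ℕ → ℕ} → (∀ {k} → k < n → f k ≡ g k) → sumBelow n f ≡ sumBelow n g
sumBelow-cong zero    f≗g = refl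
sumBelow-cong (suc n) f≗g = cong₂ _+_ (f≗g (s≤s z≤n)) (sumBelow-cong n (f≗g ∘ s≤s))

sumBelow-const : ∀ n c → sumBelow n (λ _ → c) ≡ n * c
sumBelow-const zero    c = refl
sumBelow-const (suc n) c = cong (c +_) (sumBelow-const n c)

sumBelow-+ : ∀ m n f → sumBelow (m + n) f ≡ sumBelow m f + sumBelow n (λ i → f (m + i))
sumBelow-+ zero    n f = refl
sumBelow-+ (suc m) n f = ≡-trans (cong (f 0 +_) (sumBelow-+ m n (f ∘ suc))) (sym (+-assoc (f 0) _ _))

*-distribˡ-sumBelow : ∀ c n f → c * sumBelow n f ≡ sumBelow n (λ k → c * f k)
*-distribˡ-sumBelow c zero    f = *-zeroʳ c
*-distribˡ-sumBelow c (suc n) f =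
  ≡-trans (*-distribˡ-+ c (f 0) _) (cong (c * f 0 +_) (*-distribˡ-sumBelow c n (f ∘ suc)))

sumOver-sumBelow : ∀ {a} {A : Set a} n (F : ℕ → A → ℕ) xs →
                   sumOver (λ x → sumBelow n (λ k → F k x)) xs ≡ sumBelow n (λ k → sumOver (F k) xs)
sumOver-sumBelow zero    F xs = sumOver-zero xs
sumOver-sumBelow (suc n) F xs =
  ≡-trans (sumOver-+ (F 0) _ xs) (cong (sumOver (F 0) xs +_) (sumOver-sumBelow n (F ∘ suc) xs))

module _ {a} {A : Set a} where

  -- Positions beyond the end of the list insert at the end.
  insertAt : ℕ → A → List A → List A
  insertAt zero    x ys       = x ∷ ys
  insertAt (suc k) x []       = x ∷ []
  insertAt (suc k) x (y ∷ ys) = y ∷ insertAt k x ys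

  insertAt-↭ : ∀ k x ys → insertAt k x ys ↭ x ∷ ys
  insertAt-↭ zero    x ys       = refl
  insertAt-↭ (suc k) x []       = refl
  insertAt-↭ (suc k) x (y ∷ ys) = trans (prep y (insertAt-↭ k x ys)) (swap y x refl)

  Unique-insertAt : ∀ k {x ys} → All (¬_ ∘ (x ≡_)) ys → Unique ys → Unique (insertAt k x ys)
  Unique-insertAt zero    x∉ys              !ys          = x∉ys ∷ !ys
  Unique-insertAt (suc k) {ys = []}     _   _            = [] ∷ []
  Unique-insertAt (suc k) {ys = y ∷ ys} (x≢y ∷ x∉ys) (y∉ys ∷ !ys) =
    All-resp-↭ (↭-sym (insertAt-↭ k _ ys)) ((x≢y ∘ sym) ∷ y∉ys) ∷ Unique-insertAt k x∉ys !ys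

  take-insertAt-≤ : ∀ {k j} x ys → k ≤ j → take (suc j) (insertAt k x ys) ≡ insertAt k x (take j ys)
  take-insertAt-≤ {zero}            x ys       _         = refl
  take-insertAt-≤ {suc k} {suc j}   x []       _         = refl
  take-insertAt-≤ {suc k} {suc j}   x (y ∷ ys) (s≤s k≤j) = cong (y ∷_) (take-insertAt-≤ x ys k≤j)

  drop-insertAt-≤ : ∀ {k j} x ys → k ≤ j → drop (suc j) (insertAt k x ys) ≡ drop j ys
  drop-insertAt-≤ {zero}            x ys       _         = refl
  drop-insertAt-≤ {suc k} {suc j}   x []       _         = refl
  drop-insertAt-≤ {suc k} {suc j}   x (y ∷ ys) (s≤s k≤j) = drop-insertAt-≤ x ys k≤j

  take-insertAt-+ : ∀ j i x ys → j ≤ length ys → take j (insertAt (j + i) x ys) ≡ take j ys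
  take-insertAt-+ zero    i x ys       _         = refl
  take-insertAt-+ (suc j) i x (y ∷ ys) (s≤s j≤) = cong (y ∷_) (take-insertAt-+ j i x ys j≤)

  drop-insertAt-+ : ∀ j i x ys → j ≤ length ys → drop j (insertAt (j + i) x ys) ≡ insertAt i x (drop j ys)
  drop-insertAt-+ zero    i x ys       _         = refl
  drop-insertAt-+ (suc j) i x (y ∷ ys) (s≤s j≤) = drop-insertAt-+ j i x ys j≤

  take-suc-++ : ∀ j (xs : List A) → take (suc j) xs ≡ take j xs ++ take 1 (drop j xs)
  take-suc-++ zero    []       = refl
  take-suc-++ zero    (x ∷ xs) = refl
  take-suc-++ (suc j) []       = refl
  take-suc-++ (suc j) (x ∷ xs) = cong (x ∷_) (take-suc-++ j xs)

  drop-nonEmpty : ∀ j (xs : List A) → j < length xs → 0 < length (drop j xs)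
  drop-nonEmpty zero    (x ∷ xs) _         = s≤s z≤n
  drop-nonEmpty (suc j) (x ∷ xs) (s≤s j<) = drop-nonEmpty j xs j<

  sumOver-insertAt : ∀ w k x ys → sumOver w (insertAt k x ys) ≡ w x + sumOver w ys
  sumOver-insertAt w k x ys = sumOver-↭ w (insertAt-↭ k x ys)

  atSplit : ∀ {b} {B : Set b} → ℕ → (List A → List A → B) → List A → B
  atSplit j φ xs = φ (take j xs) (drop j xs)

  atSplit-insertAt-front : ∀ {b} {B : Set b} {k j} (φ : List A → List A → B) x ys → k ≤ j →
                           atSplit (suc j) φ (insertAt k x ys) ≡ atSplit j (φ ∘ insertAt k x) ys
  atSplit-insertAt-front φ x ys k≤j = cong₂ φ (take-insertAt-≤ x ys k≤j) (drop-insertAt-≤ x ys k≤j)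

  atSplit-insertAt-back : ∀ {b} {B : Set b} j i (φ : List A → List A → B) x ys → j ≤ length ys →
                          atSplit j φ (insertAt (j + i) x ys) ≡ φ (take j ys) (insertAt i x (drop j ys))
  atSplit-insertAt-back j i φ x ys j≤ = cong₂ φ (take-insertAt-+ j i x ys j≤) (drop-insertAt-+ j i x ys j≤)

sumOver-insertions : ∀ (w : List ℕ → ℕ) x σ →
                     sumOver w (insertions x σ) ≡ sumBelow (suc (length σ)) (λ k → w (insertAt k x σ))
sumOver-insertions w x []       = refl
sumOver-insertions w x (y ∷ ys) = cong (w (x ∷ y ∷ ys) +_)
  (≡-trans (sumOver-map w (y ∷_) (insertions x ys)) (sumOver-insertions (w ∘ (y ∷_)) x ys))

All-insertions : ∀ {p} {P : List ℕ → Set p} x σ → (∀ k → P (insertAt k x σ)) → All P (insertions x σ)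
All-insertions x []       P-ins = P-ins 0 ∷ []
All-insertions x (y ∷ ys) P-ins = P-ins 0 ∷ map⁺ (All-insertions x ys (P-ins ∘ suc))

-- The invariant of perms n that the argument uses; it does not record that values are positive.
IsPerm : ℕ → List ℕ → Set
IsPerm n σ = length σ ≡ n × All (_≤ n) σ × Unique σ

IsPerm-insertAt : ∀ {n σ} → IsPerm n σ → ∀ k → IsPerm (suc n) (insertAt k (suc n) σ)
IsPerm-insertAt {n} {σ} (len , σ≤n , !σ) k =
  ≡-trans (↭-length (insertAt-↭ k _ σ)) (cong suc len) ,
  All-resp-↭ (↭-sym (insertAt-↭ k _ σ)) (≤-refl ∷ All.map m≤n⇒m≤1+n σ≤n) ,
  Unique-insertAt k (All.map (λ v≤n 1+n≡v → 1+n≰n (subst (_≤ n) (sym 1+n≡v) v≤n)) σ≤n) !σ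

perms-isPerm : ∀ n → All (IsPerm n) (perms n)
perms-isPerm zero    = (refl , [] , []) ∷ []
perms-isPerm (suc n) =
  concat⁺ (gmap⁺ (λ σ-perm → All-insertions (suc n) _ (IsPerm-insertAt σ-perm)) (perms-isPerm n))

sumPerms : ℕ → (List ℕ → ℕ) → ℕ
sumPerms n w = sumOver w (perms n)

frontInsertions : ℕ → ℕ → (List ℕ → ℕ) → List ℕ → ℕ
frontInsertions j x w σ = sumBelow j (λ k → w (insertAt k x σ))

sumPerms-suc : ∀ n w → sumPerms (suc n) w ≡ sumPerms n (frontInsertions (suc n) (suc n) w)
sumPerms-suc n w = ≡-trans (sumOver-concatMap w (insertions (suc n)) (perms n))
  (sumOver-congᴬ (λ { {σ} (refl , _) → sumOver-insertions w (suc n) σ }) (perms-isPerm n))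

length-perms-suc : ∀ n → length (perms (suc n)) ≡ suc n * length (perms n)
length-perms-suc n = begin
  length (perms (suc n))                           ≡⟨ length≡sumOver-1 (perms (suc n)) ⟩
  sumPerms (suc n) (λ _ → 1)                       ≡⟨ sumPerms-suc n (λ _ → 1) ⟩
  sumPerms n (λ _ → sumBelow (suc n) (λ _ → 1))    ≡⟨ sumOver-cong (λ _ → sumBelow-const (suc n) 1) (perms n) ⟩
  sumPerms n (λ _ → suc n * 1)                     ≡⟨ sumOver-*ˡ (suc n) (λ _ → 1) (perms n) ⟩
  suc n * sumPerms n (λ _ → 1)                     ≡⟨ cong (suc n *_) (length≡sumOver-1 (perms n)) ⟨
  suc n * length (perms n)                         ∎
  where open ≡-Reasoning

-- A test R p v asks whether the value v fits the prefix p.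
Test : Set
Test = List ℕ → ℕ → Bool

headHits : (ℕ → Bool) → List ℕ → ℕ
headHits P []      = 0
headHits P (v ∷ _) = 𝟙 (P v)

hitsNext : ℕ → Test → List ℕ → ℕ
hitsNext j R = atSplit j (headHits ∘ R)

hitsLater : ℕ → Test → List ℕ → ℕ
hitsLater j R = atSplit j (λ p → sumOver (𝟙 ∘ R p))

frontInsertions-atSplit : ∀ j (φ : List ℕ → List ℕ → ℕ) x {n} σ → length σ ≡ n → j ≤ n →
  frontInsertions (suc n) x (atSplit j φ) σ ≡
  frontInsertions j x (atSplit j φ) σ + sumBelow (suc (n ∸ j)) (λ i → φ (take j σ) (insertAt i x (drop j σ)))
frontInsertions-atSplit j φ x {n} σ refl j≤n = begin
  sumBelow (suc n) f                                       ≡⟨ cong (λ m → sumBelow m f) positions ⟩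
  sumBelow (j + suc (n ∸ j)) f                             ≡⟨ sumBelow-+ j (suc (n ∸ j)) f ⟩
  sumBelow j f + sumBelow (suc (n ∸ j)) (λ i → f (j + i))  ≡⟨ cong (sumBelow j f +_) back ⟩
  sumBelow j f + sumBelow (suc (n ∸ j)) (λ i → φ (take j σ) (insertAt i x (drop j σ))) ∎
  where
  open ≡-Reasoning
  f = λ k → atSplit j φ (insertAt k x σ)
  positions : suc n ≡ j + suc (n ∸ j)
  positions = sym (≡-trans (+-suc j (n ∸ j)) (cong suc (m+[n∸m]≡n j≤n)))
  back = sumBelow-cong (suc (n ∸ j)) (λ {i} _ → atSplit-insertAt-back j i φ x σ j≤n)

sumBelow-headHits-insertAt : ∀ P x l {m} → length l ≡ m →
  sumBelow (suc m) (λ i → headHits P (insertAt i x l)) ≡ 𝟙 (P x) + m * headHits P l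
sumBelow-headHits-insertAt P x []      refl = refl
sumBelow-headHits-insertAt P x (v ∷ l) refl = cong (𝟙 (P x) +_) (sumBelow-const (suc (length l)) (𝟙 (P v)))

frontInsertions-hitsNext : ∀ j R x {n} σ → length σ ≡ n → j ≤ n →
  frontInsertions (suc n) x (hitsNext j R) σ ≡
  frontInsertions j x (hitsNext j R) σ + (𝟙 (R (take j σ) x) + (n ∸ j) * hitsNext j R σ)
frontInsertions-hitsNext j R x σ refl j≤n =
  ≡-trans (frontInsertions-atSplit j (headHits ∘ R) x σ refl j≤n)
          (cong (frontInsertions j x (hitsNext j R) σ +_)
                (sumBelow-headHits-insertAt (R (take j σ)) x (drop j σ) (length-drop j σ)))

frontInsertions-hitsLater : ∀ j R x {n} σ → length σ ≡ n → j ≤ n →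
  frontInsertions (suc n) x (hitsLater j R) σ ≡
  frontInsertions j x (hitsLater j R) σ + suc (n ∸ j) * (𝟙 (R (take j σ) x) + hitsLater j R σ)
frontInsertions-hitsLater j R x {n} σ refl j≤n =
  ≡-trans (frontInsertions-atSplit j (λ p → sumOver (𝟙 ∘ R p)) x σ refl j≤n) $
  cong (frontInsertions j x (hitsLater j R) σ +_) $
  ≡-trans (sumBelow-cong (suc (n ∸ j)) (λ {i} _ → sumOver-insertAt (𝟙 ∘ R (take j σ)) i x (drop j σ)))
          (sumBelow-const (suc (n ∸ j)) (𝟙 (R (take j σ) x) + hitsLater j R σ))

sumPerms-suc-hitsNext : ∀ n j R → j ≤ n →
  sumPerms (suc n) (hitsNext j R) ≡
  sumPerms n (frontInsertions j (suc n) (hitsNext j R)) +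
  (sumPerms n (λ σ → 𝟙 (R (take j σ) (suc n))) + (n ∸ j) * sumPerms n (hitsNext j R))
sumPerms-suc-hitsNext n j R j≤n = begin
  sumPerms (suc n) (hitsNext j R)
    ≡⟨ sumPerms-suc n (hitsNext j R) ⟩
  sumPerms n (frontInsertions (suc n) (suc n) (hitsNext j R))
    ≡⟨ sumOver-congᴬ (λ { (len , _) → frontInsertions-hitsNext j R (suc n) _ len j≤n }) (perms-isPerm n) ⟩
  sumPerms n (λ σ → front σ + (B σ + (n ∸ j) * hitsNext j R σ))
    ≡⟨ sumOver-+ front _ (perms n) ⟩
  sumPerms n front + sumPerms n (λ σ → B σ + (n ∸ j) * hitsNext j R σ)
    ≡⟨ cong (sumPerms n front +_) (sumOver-+ B _ (perms n)) ⟩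
  sumPerms n front + (sumPerms n B + sumPerms n (λ σ → (n ∸ j) * hitsNext j R σ))
    ≡⟨ cong (λ t → sumPerms n front + (sumPerms n B + t)) (sumOver-*ˡ (n ∸ j) (hitsNext j R) (perms n)) ⟩
  sumPerms n front + (sumPerms n B + (n ∸ j) * sumPerms n (hitsNext j R)) ∎
  where
  open ≡-Reasoning
  front = frontInsertions j (suc n) (hitsNext j R)
  B = λ σ → 𝟙 (R (take j σ) (suc n))

sumPerms-suc-hitsLater : ∀ n j R → j ≤ n →
  sumPerms (suc n) (hitsLater j R) ≡
  sumPerms n (frontInsertions j (suc n) (hitsLater j R)) +
  suc (n ∸ j) * (sumPerms n (λ σ → 𝟙 (R (take j σ) (suc n))) + sumPerms n (hitsLater j R))
sumPerms-suc-hitsLater n j R j≤n = begin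
  sumPerms (suc n) (hitsLater j R)
    ≡⟨ sumPerms-suc n (hitsLater j R) ⟩
  sumPerms n (frontInsertions (suc n) (suc n) (hitsLater j R))
    ≡⟨ sumOver-congᴬ (λ { (len , _) → frontInsertions-hitsLater j R (suc n) _ len j≤n }) (perms-isPerm n) ⟩
  sumPerms n (λ σ → front σ + suc (n ∸ j) * (B σ + hitsLater j R σ))
    ≡⟨ sumOver-+ front _ (perms n) ⟩
  sumPerms n front + sumPerms n (λ σ → suc (n ∸ j) * (B σ + hitsLater j R σ))
    ≡⟨ cong (sumPerms n front +_) (sumOver-*ˡ (suc (n ∸ j)) _ (perms n)) ⟩
  sumPerms n front + suc (n ∸ j) * sumPerms n (λ σ → B σ + hitsLater j R σ)
    ≡⟨ cong (λ t → sumPerms n front + suc (n ∸ j) * t) (sumOver-+ B (hitsLater j R) (perms n)) ⟩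
  sumPerms n front + suc (n ∸ j) * (sumPerms n B + sumPerms n (hitsLater j R)) ∎
  where
  open ≡-Reasoning
  front = frontInsertions j (suc n) (hitsLater j R)
  B = λ σ → 𝟙 (R (take j σ) (suc n))

sumOver-frontInsertions : ∀ j (φ : List ℕ → List ℕ → ℕ) x L →
  sumOver (frontInsertions (suc j) x (atSplit (suc j) φ)) L ≡
  sumBelow (suc j) (λ k → sumOver (atSplit j (φ ∘ insertAt k x)) L)
sumOver-frontInsertions j φ x L =
  ≡-trans (sumOver-cong (λ σ → sumBelow-cong (suc j) (λ k<1+j → atSplit-insertAt-front φ x σ (≤-pred k<1+j))) L)
          (sumOver-sumBelow (suc j) (λ k → atSplit j (φ ∘ insertAt k x)) L)

sumPerms-hitsLater : ∀ n j R → j ≤ n → sumPerms n (hitsLater j R) ≡ (n ∸ j) * sumPerms n (hitsNext j R)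
sumPerms-hitsLater zero    zero R z≤n   = refl
sumPerms-hitsLater (suc n) j    R j≤1+n with m≤n⇒m<n∨m≡n j≤1+n
... | inj₂ refl = begin
  sumPerms (suc n) (hitsLater (suc n) R) ≡⟨ sumOver-congᴬ exhausted (perms-isPerm (suc n)) ⟩
  sumPerms (suc n) (λ _ → 0)             ≡⟨ sumOver-zero (perms (suc n)) ⟩
  0                                      ≡⟨ cong (_* sumPerms (suc n) (hitsNext (suc n) R)) (n∸n≡0 n) ⟨
  (n ∸ n) * sumPerms (suc n) (hitsNext (suc n) R) ∎
  where
  open ≡-Reasoning
  exhausted : ∀ {σ} → IsPerm (suc n) σ → hitsLater (suc n) R σ ≡ 0
  exhausted {σ} (len , _) = cong (sumOver _) (drop-all (suc n) σ (≤-reflexive len))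
... | inj₁ (s≤s j≤n) = begin
  sumPerms (suc n) (hitsLater j R)                       ≡⟨ sumPerms-suc-hitsLater n j R j≤n ⟩
  front j (hitsLater j R) + suc d * (B + sumPerms n (hitsLater j R))
    ≡⟨ cong₂ (λ u v → u + suc d * (B + v)) (front-exchange j j≤n) (sumPerms-hitsLater n j R j≤n) ⟩
  suc d * front j (hitsNext j R) + suc d * (B + d * C)     ≡⟨ *-distribˡ-+ (suc d) (front j (hitsNext j R)) (B + d * C) ⟨
  suc d * (front j (hitsNext j R) + (B + d * C))           ≡⟨ cong₂ _*_ (+-∸-assoc 1 j≤n) (sumPerms-suc-hitsNext n j R j≤n) ⟨
  (suc n ∸ j) * sumPerms (suc n) (hitsNext j R)          ∎
  where
  open ≡-Reasoning
  d = n ∸ j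
  B = sumPerms n (λ σ → 𝟙 (R (take j σ) (suc n)))
  C = sumPerms n (hitsNext j R)
  front : ℕ → (List ℕ → ℕ) → ℕ
  front i w = sumPerms n (frontInsertions i (suc n) w)
  -- Inserting n+1 before position i shifts the split point by one: the induction hypothesis
  -- applies to the test with n+1 inserted into the prefix.
  front-exchange : ∀ i → i ≤ n → front i (hitsLater i R) ≡ suc (n ∸ i) * front i (hitsNext i R)
  front-exchange zero    _     = begin
    front 0 (hitsLater 0 R)        ≡⟨ sumOver-zero (perms n) ⟩
    0                              ≡⟨ *-zeroʳ (suc n) ⟨
    suc n * 0                      ≡⟨ cong (suc n *_) (sumOver-zero (perms n)) ⟨
    suc n * front 0 (hitsNext 0 R) ∎
  front-exchange (suc i) 1+i≤n = begin
    front (suc i) (hitsLater (suc i) R)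
      ≡⟨ sumOver-frontInsertions i (λ p → sumOver (𝟙 ∘ R p)) (suc n) (perms n) ⟩
    sumBelow (suc i) (λ k → sumPerms n (hitsLater i (R ∘ insertAt k (suc n))))
      ≡⟨ sumBelow-cong (suc i) (λ {k} _ → sumPerms-hitsLater n i (R ∘ insertAt k (suc n)) (≤-trans (n≤1+n i) 1+i≤n)) ⟩
    sumBelow (suc i) (λ k → (n ∸ i) * sumPerms n (hitsNext i (R ∘ insertAt k (suc n))))
      ≡⟨ *-distribˡ-sumBelow (n ∸ i) (suc i) (λ k → sumPerms n (hitsNext i (R ∘ insertAt k (suc n)))) ⟨
    (n ∸ i) * sumBelow (suc i) (λ k → sumPerms n (hitsNext i (R ∘ insertAt k (suc n))))
      ≡⟨ cong₂ _*_ (+-∸-assoc 1 1+i≤n) (sym (sumOver-frontInsertions i (headHits ∘ R) (suc n) (perms n))) ⟩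
    suc (n ∸ suc i) * front (suc i) (hitsNext (suc i) R) ∎

≡ᵇ-true⇒≡ : ∀ {m n} → (m ≡ᵇ n) ≡ true → m ≡ n
≡ᵇ-true⇒≡ {m} {n} eq = ≡ᵇ⇒≡ m n (Equivalence.from T-≡ eq)

headHits-≡ᵇ-< : ∀ {s} l → All (_< s) l → headHits (s ≡ᵇ_) l ≡ 0
headHits-≡ᵇ-< []      []          = refl
headHits-≡ᵇ-< (v ∷ l) (v<s ∷ _) = cong 𝟙 (¬-not (<⇒≢ v<s ∘ sym ∘ ≡ᵇ-true⇒≡))

sumIs : Test
sumIs p v = sum p ≡ᵇ v

-- F a n counts the permutations σ of {1,…,n} with σ(a+1) = σ(1)+⋯+σ(a);
-- G a n those with σ(1)+⋯+σ(a) = n+1.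
F : ℕ → ℕ → ℕ
F a n = sumPerms n (hitsNext a sumIs)

G : ℕ → ℕ → ℕ
G a n = sumPerms n (λ σ → 𝟙 (sum (take a σ) ≡ᵇ suc n))

-- Inserted among the first a entries, n+1 makes their sum exceed every later entry.
frontInsertions-sumIs : ∀ a {n σ} → IsPerm n σ → frontInsertions a (suc n) (hitsNext a sumIs) σ ≡ 0
frontInsertions-sumIs zero    _              = refl
frontInsertions-sumIs (suc a) {n} {σ} (_ , σ≤n , _) = begin
  sumBelow (suc a) (λ k → hitsNext (suc a) sumIs (insertAt k (suc n) σ)) ≡⟨ sumBelow-cong (suc a) vanish ⟩
  sumBelow (suc a) (λ _ → 0)                                               ≡⟨ sumBelow-const (suc a) 0 ⟩
  suc a * 0                                                                 ≡⟨ *-zeroʳ (suc a) ⟩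
  0                                                                         ∎
  where
  open ≡-Reasoning
  vanish : ∀ {k} → k < suc a → hitsNext (suc a) sumIs (insertAt k (suc n) σ) ≡ 0
  vanish {k} k<1+a = begin
    hitsNext (suc a) sumIs (insertAt k (suc n) σ)                 ≡⟨ atSplit-insertAt-front (headHits ∘ sumIs) (suc n) σ (≤-pred k<1+a) ⟩
    headHits (sum (insertAt k (suc n) (take a σ)) ≡ᵇ_) (drop a σ) ≡⟨ cong (λ s → headHits (s ≡ᵇ_) (drop a σ)) (sum-↭ (insertAt-↭ k (suc n) (take a σ))) ⟩
    headHits (suc n + sum (take a σ) ≡ᵇ_) (drop a σ)              ≡⟨ headHits-≡ᵇ-< (drop a σ) (drop⁺ a (All.map (λ v≤n → s≤s (≤-trans v≤n (m≤m+n n _))) σ≤n)) ⟩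
    0                                                               ∎

F-suc : ∀ a d → F a (suc (d + a)) ≡ G a (d + a) + d * F a (d + a)
F-suc a d = begin
  F a (suc n)                                                        ≡⟨ sumPerms-suc-hitsNext n a sumIs (m≤n+m a d) ⟩
  sumPerms n (frontInsertions a (suc n) (hitsNext a sumIs)) + (G a n + (n ∸ a) * F a n)
    ≡⟨ cong (_+ (G a n + (n ∸ a) * F a n)) (≡-trans (sumOver-congᴬ (frontInsertions-sumIs a) (perms-isPerm n)) (sumOver-zero (perms n))) ⟩
  G a n + (n ∸ a) * F a n                                            ≡⟨ cong (λ m → G a n + m * F a n) (m+n∸n≡m d a) ⟩
  G a n + d * F a n                                                  ∎
  where
  open ≡-Reasoning
  n = d + a

completes : ℕ → Test
completes x p v = sum (p ++ v ∷ []) ≡ᵇ x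

completes-injective : ∀ x p {u v} → completes x p u ≡ true → completes x p v ≡ true → u ≡ v
completes-injective x p {u} {v} pu pv = +-cancelʳ-≡ _ _ _ $ +-cancelˡ-≡ (sum p) _ _ $ begin
  sum p + (u + 0)        ≡⟨ sum-++ p (u ∷ []) ⟨
  sum (p ++ u ∷ [])      ≡⟨ ≡-trans (≡ᵇ-true⇒≡ pu) (sym (≡ᵇ-true⇒≡ pv)) ⟩
  sum (p ++ v ∷ [])      ≡⟨ sum-++ p (v ∷ []) ⟩
  sum p + (v + 0)        ∎
  where open ≡-Reasoning

sum-take-suc-as-hitsNext : ∀ j x σ → j < length σ → 𝟙 (sum (take (suc j) σ) ≡ᵇ x) ≡ hitsNext j (completes x) σ
sum-take-suc-as-hitsNext j x σ j<len rewrite take-suc-++ j σ = nonEmpty (take j σ) (drop j σ) (drop-nonEmpty j σ j<len)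
  where
  nonEmpty : ∀ p l → 0 < length l → 𝟙 (sum (p ++ take 1 l) ≡ᵇ x) ≡ headHits (completes x p) l
  nonEmpty p (v ∷ l) _ = refl

G-bound : ∀ a d → suc d * G (suc a) (d + suc a) ≤ length (perms (d + suc a))
G-bound a d = begin
  suc d * G (suc a) n
    ≡⟨ cong (_* G (suc a) n) (≡-trans (cong (_∸ a) (+-suc d a)) (m+n∸n≡m (suc d) a)) ⟨
  (n ∸ a) * G (suc a) n
    ≡⟨ cong ((n ∸ a) *_) (sumOver-congᴬ (λ { {σ} (len , _) → sum-take-suc-as-hitsNext a (suc n) σ (subst (a <_) (sym len) a<n) }) (perms-isPerm n)) ⟩
  (n ∸ a) * sumPerms n (hitsNext a (completes (suc n)))
    ≡⟨ sumPerms-hitsLater n a (completes (suc n)) (≤-trans (n≤1+n a) a<n) ⟨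
  sumPerms n (hitsLater a (completes (suc n)))
    ≤⟨ sumOver-monoᴬ (λ { {σ} (_ , _ , !σ) → sumOver-𝟙-≤1 _ (completes-injective (suc n) (take a σ)) (Unique.drop⁺ a !σ) }) (perms-isPerm n) ⟩
  sumPerms n (λ _ → 1)
    ≡⟨ length≡sumOver-1 (perms n) ⟨
  length (perms n) ∎
  where
  open ≤-Reasoning
  n = d + suc a
  a<n : a < n
  a<n = m≤n+m (suc a) d

countZero≡F : ∀ n a → a < n → countZero n a 1 ≡ F a n
countZero≡F n a a<n = ≡-trans (length-filter≡sumOver (λ σ → D a 1 σ ℤ.≟ ℤ.+ 0) (perms n))
  (sumOver-congᴬ (λ { {σ} (refl , _) → nonEmpty (sum (take a σ)) (drop a σ) (drop-nonEmpty a σ a<n) }) (perms-isPerm n))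
  where
  nonEmpty : ∀ s l → 0 < length l → 𝟙 (does (ℤ.+ s ℤ.- ℤ.+ sum (take 1 l) ℤ.≟ ℤ.+ 0)) ≡ headHits (s ≡ᵇ_) l
  nonEmpty s (v ∷ l) _ = cong 𝟙 (does-⇔ (mk⇔ to from) (ℤ.+ s ℤ.- ℤ.+ (v + 0) ℤ.≟ ℤ.+ 0) (s ≟ v))
    where
    to : ℤ.+ s ℤ.- ℤ.+ (v + 0) ≡ ℤ.+ 0 → s ≡ v
    to eq = ≡-trans (ℤ.+-injective (ℤ.i-j≡0⇒i≡j _ _ eq)) (+-identityʳ v)
    from : s ≡ v → ℤ.+ s ℤ.- ℤ.+ (v + 0) ≡ ℤ.+ 0
    from eq = ℤ.i≡j⇒i-j≡0 (cong ℤ.+_ (≡-trans eq (sym (+-identityʳ v))))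

bound-base : ∀ a {F₀ F₁ F₂ G₀ G₁ N₀ N₁ N₂} →
  F₁ ≡ G₀ + 0 * F₀ → F₂ ≡ G₁ + 1 * F₁ → 1 * G₀ ≤ N₀ → 2 * G₁ ≤ N₁ →
  N₁ ≡ (1 + a) * N₀ → N₂ ≡ (2 + a) * N₁ →
  F₂ * (2 * (1 + 0 + a) * (a + 1)) ≤ (2 + 0 + a) * N₂
bound-base a {F₀} {G₀ = G₀} {G₁} {N₀} refl refl G₀≤ G₁≤ refl refl = begin
  (G₁ + 1 * (G₀ + 0 * F₀)) * (2 * (1 + 0 + a) * (a + 1))             ≡⟨ split a F₀ G₀ G₁ ⟩
  (2 * G₁) * ((a + 1) * (a + 1)) + (1 * G₀) * (2 * (a + 1) * (a + 1))
    ≤⟨ +-mono-≤ (*-monoˡ-≤ ((a + 1) * (a + 1)) G₁≤) (*-monoˡ-≤ (2 * (a + 1) * (a + 1)) G₀≤) ⟩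
  ((1 + a) * N₀) * ((a + 1) * (a + 1)) + N₀ * (2 * (a + 1) * (a + 1)) ≡⟨ collect a N₀ ⟩
  N₀ * ((a + 1) * (a + 1) * (a + 3))                                   ≤⟨ *-monoʳ-≤ N₀ (m≤m+n _ (a + 1)) ⟩
  N₀ * ((a + 1) * (a + 1) * (a + 3) + (a + 1))                         ≡⟨ square a N₀ ⟩
  (2 + 0 + a) * ((2 + a) * ((1 + a) * N₀))                             ∎
  where
  open ≤-Reasoning
  split : ∀ a F₀ G₀ G₁ → (G₁ + 1 * (G₀ + 0 * F₀)) * (2 * (1 + 0 + a) * (a + 1)) ≡
                         (2 * G₁) * ((a + 1) * (a + 1)) + (1 * G₀) * (2 * (a + 1) * (a + 1))
  split = solve-∀
  collect : ∀ a N₀ → ((1 + a) * N₀) * ((a + 1) * (a + 1)) + N₀ * (2 * (a + 1) * (a + 1)) ≡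
                     N₀ * ((a + 1) * (a + 1) * (a + 3))
  collect = solve-∀
  square : ∀ a N₀ → N₀ * ((a + 1) * (a + 1) * (a + 3) + (a + 1)) ≡ (2 + 0 + a) * ((2 + a) * ((1 + a) * N₀))
  square = solve-∀

-- Stated for a = 2 + p and n = 2 + q + a, where the polynomial inequality needed holds
-- with a remainder having nonnegative coefficients in p and q.
bound-step : ∀ p q {F F′ G N N′} →
  F′ ≡ G + (2 + q) * F → (3 + q) * G ≤ N → N′ ≡ (3 + q + (2 + p)) * N →
  F * (2 * (1 + q + (2 + p)) * (2 + p + 1)) ≤ (2 + q + (2 + p)) * N →
  F′ * (2 * (2 + q + (2 + p)) * (2 + p + 1)) ≤ (3 + q + (2 + p)) * N′
bound-step p q {F} {G = G} {N} refl G≤ refl IH = *-cancelˡ-≤ K $ begin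
  K * ((G + (2 + q) * F) * (2 * (2 + q + a) * (a + 1)))          ≡⟨ split p q F G ⟩
  A * ((3 + q) * G) + B * (F * (2 * (1 + q + a) * (a + 1)))     ≤⟨ +-mono-≤ (*-monoʳ-≤ A G≤) (*-monoʳ-≤ B IH) ⟩
  A * N + B * ((2 + q + a) * N)                                 ≡⟨ collect p q N ⟩
  N * (A + B * (2 + q + a))                                     ≤⟨ *-monoʳ-≤ N (m≤m+n _ (remainder)) ⟩
  N * (A + B * (2 + q + a) + remainder)                     ≡⟨ square p q N ⟩
  K * ((3 + q + a) * ((3 + q + a) * N))                         ∎
  where
  open ≤-Reasoning
  a = 2 + p
  K = (1 + q + a) * (3 + q)
  A = 2 * (2 + q + a) * (a + 1) * (1 + q + a)
  B = (3 + q) * (2 + q + a) * (2 + q)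
  remainder : ℕ
  remainder = 57 + 70 * q + 26 * (q * q) + 3 * (q * q * q) + 51 * p + 55 * p * q + 15 * p * q * q
    + p * q * q * q + 13 * p * p + 13 * p * p * q + 2 * p * p * q * q + p * p * p + p * p * p * q
  split : ∀ p q F G →
    (1 + q + (2 + p)) * (3 + q) * ((G + (2 + q) * F) * (2 * (2 + q + (2 + p)) * (2 + p + 1))) ≡
    2 * (2 + q + (2 + p)) * (2 + p + 1) * (1 + q + (2 + p)) * ((3 + q) * G) +
    (3 + q) * (2 + q + (2 + p)) * (2 + q) * (F * (2 * (1 + q + (2 + p)) * (2 + p + 1)))
  split = solve-∀
  collect : ∀ p q N →
    2 * (2 + q + (2 + p)) * (2 + p + 1) * (1 + q + (2 + p)) * N +
    (3 + q) * (2 + q + (2 + p)) * (2 + q) * ((2 + q + (2 + p)) * N) ≡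
    N * (2 * (2 + q + (2 + p)) * (2 + p + 1) * (1 + q + (2 + p)) + (3 + q) * (2 + q + (2 + p)) * (2 + q) * (2 + q + (2 + p)))
  collect = solve-∀
  square : ∀ p q N →
    N * (2 * (2 + q + (2 + p)) * (2 + p + 1) * (1 + q + (2 + p)) + (3 + q) * (2 + q + (2 + p)) * (2 + q) * (2 + q + (2 + p))
         + (57 + 70 * q + 26 * (q * q) + 3 * (q * q * q) + 51 * p + 55 * p * q + 15 * p * q * q
            + p * q * q * q + 13 * p * p + 13 * p * p * q + 2 * p * p * q * q + p * p * p + p * p * p * q)) ≡
    (1 + q + (2 + p)) * (3 + q) * ((3 + q + (2 + p)) * ((3 + q + (2 + p)) * N))
  square = solve-∀

F-bound : ∀ p q → let a = 2 + p; n = 2 + q + a in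
  F a n * (2 * (1 + q + a) * (a + 1)) ≤ n * length (perms n)
F-bound p zero    =
  bound-base a {F a a} {F a (1 + a)} {F a (2 + a)} {G a a} {G a (1 + a)} {N a} {N (1 + a)} {N (2 + a)}
    (F-suc a 0) (F-suc a 1) (G-bound (suc p) 0) (G-bound (suc p) 1) (length-perms-suc a) (length-perms-suc (1 + a))
  where
  a = 2 + p
  N = λ n → length (perms n)
F-bound p (suc q) =
  bound-step p q {F a n} {F a (suc n)} {G a n} {N n} {N (suc n)}
    (F-suc a (2 + q)) (G-bound (suc p) (2 + q)) (length-perms-suc n) (F-bound p q)
  where
  a = 2 + p
  n = 2 + q + a
  N = λ n → length (perms n)

lemma8 : (n a : ℕ) → 1 < a → a + 1 < n →
    countZero n a 1 * (2 * (n ∸ 1) * (a + 1)) ≤ n * length (perms n)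
lemma8 n zero          ()          _
lemma8 n (suc zero)    (s≤s ())    _
lemma8 n a@(suc (suc p)) _ a+1<n = begin
  countZero n a 1 * (2 * (n ∸ 1) * (a + 1)) ≡⟨ cong (λ c → c * (2 * (n ∸ 1) * (a + 1))) (countZero≡F n a a<n) ⟩
  F a n * (2 * (n ∸ 1) * (a + 1))           ≡⟨ cong (λ m → F a m * (2 * (m ∸ 1) * (a + 1))) n≡ ⟨
  F a m * (2 * (m ∸ 1) * (a + 1))           ≤⟨ F-bound p q ⟩
  m * length (perms m)                      ≡⟨ cong (λ m → m * length (perms m)) n≡ ⟩
  n * length (perms n)                      ∎
  where
  open ≤-Reasoning
  2+a≤n : 2 + a ≤ n
  2+a≤n = subst (_≤ n) (cong suc (+-comm a 1)) a+1<n
  a<n : a < n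
  a<n = ≤-trans (n≤1+n (suc a)) 2+a≤n
  q = n ∸ (2 + a)
  m = 2 + q + a
  n≡ : m ≡ n
  n≡ = ≡-trans (cong (2 +_) (+-comm q a)) (m+[n∸m]≡n 2+a≤n)
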